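{- Let $p_n$ denote the $n$-th prime and $\mathbb{P}$ the set of all primes. For $J\subseteq\mathbb{P}$ put $\mathbb{P}_J=\{p_n\mid n\in J\}$. Define $P^{(1)}=\mathbb{P}$ and $P^{(k)}=\mathbb{P}_{P^{(k-1)}}$ for $k\ge 2$ (so $P^{(2)}=\{p_{p_n}\}$ are the prime-indexed primes, $P^{(3)}=\{p_{p_{p_n}}\}$, etc.). Let $\mathbb{P}'$ be the unique subset $I\subseteq\mathbb{P}$ satisfying $\mathbb{P}=I\cup\mathbb{P}_I$ and $I\cap\mathbb{P}_I=\emptyset$. Then \[ \mathbb{P}'=P^{(1)}-P^{(2)}+P^{(3)}-P^{(4)}+\cdots, \] where the right-hand side is the set of primes $p$ such that the largest $k\ge1$ with $p\in P^{(k)}$ is odd (equivalently, the number of $k\ge1$ with $p\in P^{(k)}$ is odd).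
   Context: In the paper the alternating expression $P^{(1)}-P^{(2)}+P^{(3)}-\cdots$ is a formal alternating union/set difference of the nested sets $P^{(1)}\supseteq P^{(2)}\supseteq P^{(3)}\supseteq\cdots$, evaluated prime by prime: a prime $p$ lies in the result exactly when the last (largest) $k$ with $p\in P^{(k)}$ carries a plus sign, i.e. is odd. Each prime lies in only finitely many $P^{(k)}$. The existence and uniqueness of the set $I$ used to define $\mathbb{P}'$ is a separate result. -}

module Defs where

open import Level using (0ℓ)
open import Data.Nat using (ℕ; zero; suc; _<_; _≤_; _+_; _*_)
open import Data.Nat.Primality using (Prime; prime?)
open import Data.List using (length; filter; upTo)
open import Data.Product using (Σ; _×_; ∃-syntax)
open import Data.Empty using (⊥)
open import Relation.Nullary using (¬_)
open import Relation.Unary using (Pred; _∈_; _∉_)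
open import Relation.Binary.PropositionalEquality using (_≡_)

ℙ : Pred ℕ 0ℓ
ℙ = Prime

primeCount : ℕ → ℕ
primeCount q = length (filter prime? (upTo (suc q)))

-- IsNthPrime n q  :  q = p_n, the n-th prime (1-indexed: p_1 = 2, p_2 = 3, ...),
-- i.e. q is prime and exactly n primes are ≤ q.
IsNthPrime : ℕ → ℕ → Set
IsNthPrime n q = Prime q × primeCount q ≡ n

Odd : ℕ → Set
Odd k = ∃[ m ] (k ≡ suc (2 * m))

ℙ_ : Pred ℕ 0ℓ → Pred ℕ 0ℓ
ℙ_ J q = ∃[ n ] (n ∈ J × IsNthPrime n q)

-- P⁽ k ⁾ for k ≥ 1:  P⁽1⁾ = ℙ,  P⁽k⁾ = ℙ_{P⁽k-1⁾} for k ≥ 2.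
-- (k = 0 is not used by the paper; P⁽ 0 ⁾ is set to ∅.)
P⁽_⁾ : ℕ → Pred ℕ 0ℓ
P⁽ zero ⁾ q = ⊥
P⁽ suc zero ⁾ = ℙ
P⁽ suc (suc k) ⁾ = ℙ_ (P⁽ suc k ⁾)

-- The alternating expression P⁽1⁾ − P⁽2⁾ + P⁽3⁾ − ⋯ :
-- p such that the largest k ≥ 1 with p ∈ P⁽k⁾ exists and is odd.
AltSum : Pred ℕ 0ℓ
AltSum p = ∃[ k ] (1 ≤ k × p ∈ P⁽ k ⁾ × (∀ j → k < j → p ∉ P⁽ j ⁾) × Odd k)

{-# OPTIONS --safe #-}
module Submission where

-- Write π for primeCount.  For a prime q, q ∈ P⁽k+1⁾ iff π(q) ∈ P⁽k⁾, so the largest level of q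
-- is 1 when π(q) is not prime and one more than that of π(q) otherwise; it exists since π(q) < q.
-- The hypotheses on I say that for every prime q exactly one of q and π(q) lies in I.  Hence I
-- contains the primes of level 1 and none of level 2, and q ∈ I iff π(π(q)) ∈ I when π(q) is
-- prime; by induction on the level in steps of two, q ∈ I iff its largest level is odd.

open import Defs
open import Relation.Unary using (Pred; _⊆_; _≐_; _∪_; _∩_; Empty)
open import Level using (0ℓ)
open import Data.Product using (_×_; _,_; proj₁; ∃)
open import Data.Nat using (ℕ; zero; suc; _<_; _≤_; _+_; s≤s; z≤n)
open import Data.Nat.Properties using (≤-trans; ≤-reflexive; *-suc; suc-injective)
open import Data.Nat.Induction using (<-rec)
open import Data.Nat.Primality using (Prime; prime?)
open import Data.List using (applyUpTo)
open import Data.List.Properties using (length-filter; length-applyUpTo)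
open import Data.Sum using (_⊎_; inj₁; inj₂)
open import Data.Empty using (⊥-elim)
open import Function.Bundles using (_⇔_; mk⇔; Equivalence)
open import Function.Construct.Composition using () renaming (equivalence to ⇔-trans)
open import Relation.Nullary using (¬_; yes; no)
open import Relation.Binary.PropositionalEquality using (refl; sym; trans; cong; subst)

open Equivalence using (to; from)

Odd-1 : Odd 1
Odd-1 = 0 , refl

¬Odd-2 : ¬ Odd 2
¬Odd-2 (zero , ())
¬Odd-2 (suc zero , ())
¬Odd-2 (suc (suc _) , ())

Odd⇔Odd-2+ : ∀ k → Odd k ⇔ Odd (2 + k)
Odd⇔Odd-2+ k = mk⇔ up down
  where
  up : Odd k → Odd (2 + k)
  up (m , e) = suc m , trans (cong (2 +_) e) (cong suc (sym (*-suc 2 m)))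
  down : Odd (2 + k) → Odd k
  down (zero , ())
  down (suc m , e) = m , suc-injective (suc-injective (trans e (cong suc (*-suc 2 m))))

-- Primes start at 2, so among 0, …, q at least 0 and 1 are not counted.
primeCount<self : ∀ {q} → Prime q → primeCount q < q
primeCount<self {suc (suc r)} _ = s≤s (≤-trans
  (length-filter prime? (applyUpTo (λ x → suc (suc x)) (suc r)))
  (≤-reflexive (length-applyUpTo (λ x → suc (suc x)) (suc r))))

ℙ-index : ∀ {J : Pred ℕ 0ℓ} {q} → ℙ_ J q → J (primeCount q)
ℙ-index {J} (n , n∈J , _ , πq≡n) = subst J (sym πq≡n) n∈J

ℙ-intro : ∀ {J : Pred ℕ 0ℓ} {q} → Prime q → J (primeCount q) → ℙ_ J q
ℙ-intro q-prime πq∈J = _ , πq∈J , q-prime , refl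

P⁽suc⁾⇒Prime : ∀ k {q} → P⁽ suc k ⁾ q → Prime q
P⁽suc⁾⇒Prime zero q-prime = q-prime
P⁽suc⁾⇒Prime (suc k) (_ , _ , q-prime , _) = q-prime

IsTopLevel : ℕ → ℕ → Set
IsTopLevel q k = 1 ≤ k × P⁽ k ⁾ q × (∀ j → k < j → ¬ P⁽ j ⁾ q)

IsTopLevel⇒Prime : ∀ {q k} → IsTopLevel q k → Prime q
IsTopLevel⇒Prime {k = suc k} (_ , q∈P⁽k⁾ , _) = P⁽suc⁾⇒Prime k q∈P⁽k⁾

IsTopLevel-one : ∀ {q} → Prime q → ¬ Prime (primeCount q) → IsTopLevel q 1
IsTopLevel-one {q} q-prime πq-nonprime = s≤s z≤n , q-prime , notAbove
  where
  notAbove : ∀ j → 1 < j → ¬ P⁽ j ⁾ q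
  notAbove (suc zero) (s≤s ())
  notAbove (suc (suc j)) _ q∈P⁽j⁾ = πq-nonprime (P⁽suc⁾⇒Prime j (ℙ-index q∈P⁽j⁾))

IsTopLevel-suc : ∀ {q k} → Prime q → IsTopLevel (primeCount q) (suc k) → IsTopLevel q (suc (suc k))
IsTopLevel-suc {q} {k} q-prime (_ , πq∈P⁽k⁾ , πq-notAbove) =
  s≤s z≤n , ℙ-intro q-prime πq∈P⁽k⁾ , notAbove
  where
  notAbove : ∀ j → suc (suc k) < j → ¬ P⁽ j ⁾ q
  notAbove (suc (suc j)) (s≤s k<j) q∈P⁽j⁾ = πq-notAbove (suc j) k<j (ℙ-index q∈P⁽j⁾)

IsTopLevel-pred : ∀ {q k} → IsTopLevel q (suc (suc k)) → IsTopLevel (primeCount q) (suc k)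
IsTopLevel-pred {q} {k} (_ , q∈P⁽k⁾ , q-notAbove) = s≤s z≤n , ℙ-index q∈P⁽k⁾ , notAbove
  where
  notAbove : ∀ j → suc k < j → ¬ P⁽ j ⁾ (primeCount q)
  notAbove (suc j) k<j πq∈P⁽j⁾ =
    q-notAbove (suc (suc j)) (s≤s k<j) (ℙ-intro (P⁽suc⁾⇒Prime (suc k) q∈P⁽k⁾) πq∈P⁽j⁾)

topLevel : ∀ {q} → Prime q → ∃ (IsTopLevel q)
topLevel {q} = <-rec (λ q → Prime q → ∃ (IsTopLevel q)) step q
  where
  step : ∀ q → (∀ {r} → r < q → Prime r → ∃ (IsTopLevel r)) → Prime q → ∃ (IsTopLevel q)
  step q rec q-prime with prime? (primeCount q)
  ... | no πq-nonprime = 1 , IsTopLevel-one q-prime πq-nonprime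
  ... | yes πq-prime with rec (primeCount<self q-prime) πq-prime
  ...   | suc k , πq-top = suc (suc k) , IsTopLevel-suc q-prime πq-top

module Complementary (I : Pred ℕ 0ℓ) (I⊆ℙ : I ⊆ ℙ) (ℙ≐I∪ℙ_I : ℙ ≐ (I ∪ ℙ_ I)) (I∩ℙ_I≡∅ : Empty (I ∩ ℙ_ I)) where

  self-or-primeCount : ∀ {q} → Prime q → I q ⊎ I (primeCount q)
  self-or-primeCount q-prime with proj₁ ℙ≐I∪ℙ_I q-prime
  ... | inj₁ q∈I = inj₁ q∈I
  ... | inj₂ q∈ℙ_I = inj₂ (ℙ-index q∈ℙ_I)

  not-self-and-primeCount : ∀ {q} → Prime q → I q → ¬ I (primeCount q)
  not-self-and-primeCount {q} q-prime q∈I πq∈I = I∩ℙ_I≡∅ q (q∈I , ℙ-intro q-prime πq∈I)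

  ∈I⇔primeCount²∈I : ∀ {q} → Prime q → Prime (primeCount q) → I q ⇔ I (primeCount (primeCount q))
  ∈I⇔primeCount²∈I {q} q-prime πq-prime = mk⇔ forward backward
    where
    forward : I q → I (primeCount (primeCount q))
    forward q∈I with self-or-primeCount πq-prime
    ... | inj₁ πq∈I = ⊥-elim (not-self-and-primeCount q-prime q∈I πq∈I)
    ... | inj₂ ππq∈I = ππq∈I
    backward : I (primeCount (primeCount q)) → I q
    backward ππq∈I with self-or-primeCount q-prime
    ... | inj₁ q∈I = q∈I
    ... | inj₂ πq∈I = ⊥-elim (not-self-and-primeCount πq-prime πq∈I ππq∈I)

  ∈I⇔Odd : ∀ {q k} → IsTopLevel q k → I q ⇔ Odd k
  ∈I⇔Odd {q} {suc zero} top@(_ , _ , q-notAbove) = mk⇔ (λ _ → Odd-1) (λ _ → q∈I)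
    where
    q∈I : I q
    q∈I with self-or-primeCount (IsTopLevel⇒Prime top)
    ... | inj₁ q∈I = q∈I
    ... | inj₂ πq∈I = ⊥-elim (q-notAbove 2 (s≤s (s≤s z≤n)) (ℙ-intro (IsTopLevel⇒Prime top) (I⊆ℙ πq∈I)))
  ∈I⇔Odd {q} {suc (suc zero)} top = mk⇔ (λ q∈I → ⊥-elim (q∉I q∈I)) (λ odd → ⊥-elim (¬Odd-2 odd))
    where
    q∉I : ¬ I q
    q∉I q∈I = not-self-and-primeCount (IsTopLevel⇒Prime top) q∈I
                (from (∈I⇔Odd (IsTopLevel-pred top)) Odd-1)
  ∈I⇔Odd {q} {suc (suc (suc k))} top =
    ⇔-trans (∈I⇔primeCount²∈I (IsTopLevel⇒Prime top) (IsTopLevel⇒Prime πq-top))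
            (⇔-trans (∈I⇔Odd (IsTopLevel-pred πq-top)) (Odd⇔Odd-2+ (suc k)))
    where
    πq-top : IsTopLevel (primeCount q) (suc (suc k))
    πq-top = IsTopLevel-pred top

theorem2p1 : (I : Pred ℕ 0ℓ) → I ⊆ ℙ → ℙ ≐ (I ∪ ℙ_ I) → Empty (I ∩ ℙ_ I)
    → I ≐ AltSum
theorem2p1 I I⊆ℙ ℙ≐I∪ℙ_I I∩ℙ_I≡∅ = I⊆AltSum , AltSum⊆I
  where
  open Complementary I I⊆ℙ ℙ≐I∪ℙ_I I∩ℙ_I≡∅ using (∈I⇔Odd)
  I⊆AltSum : I ⊆ AltSum
  I⊆AltSum q∈I with topLevel (I⊆ℙ q∈I)
  ... | k , top@(1≤k , q∈P⁽k⁾ , q-notAbove) = k , 1≤k , q∈P⁽k⁾ , q-notAbove , to (∈I⇔Odd top) q∈I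
  AltSum⊆I : AltSum ⊆ I
  AltSum⊆I (k , 1≤k , q∈P⁽k⁾ , q-notAbove , odd) = from (∈I⇔Odd (1≤k , q∈P⁽k⁾ , q-notAbove)) odd
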